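{- For every $d\ge 3$, $\dim(Q_d)=\mathrm{mdim}(Q_d)$.
   Context: The hypercube $Q_d$ has vertex set $\{0,1\}^d$, two vertices adjacent iff they differ in exactly one coordinate; distance $d(u,v)$ is the number of differing coordinates. For a vertex $x$ and an edge $uv$, $d(uv,x)=\min\{d(u,x),d(v,x)\}$. A vertex $x$ distinguishes two elements $a,b\in V\cup E$ (vertices or edges) if $d(a,x)\ne d(b,x)$. A set $S$ of vertices is a metric generator if every two distinct vertices are distinguished by some element of $S$, and a mixed metric generator if every two distinct elements of $V(Q_d)\cup E(Q_d)$ (any combination of vertices and edges) are distinguished by some element of $S$. $\dim(G)$ and $\mathrm{mdim}(G)$ are the minimum cardinalities of a metric generator and of a mixed metric generator of $G$, respectively. -}

module Defs where

open import Data.Bool using (Bool; true; false)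
open import Data.Nat using (ℕ; zero; suc; _⊓_; _≤_)
open import Data.Vec using (Vec; []; _∷_)
open import Data.List using (List; length)
open import Data.List.Membership.Propositional using (_∈_)
open import Data.Product using (Σ; _×_; ∃-syntax)
open import Data.Sum using (_⊎_)
open import Data.Empty using (⊥)
open import Relation.Nullary using (¬_)
open import Relation.Binary.PropositionalEquality using (_≡_; _≢_)

Vertex : ℕ → Set
Vertex d = Vec Bool d

-- Hamming distance = graph distance in Q_d.
ham : ∀ {d} → Vertex d → Vertex d → ℕ
ham []      []      = 0
ham (false ∷ u) (false ∷ v) = ham u v
ham (true  ∷ u) (true  ∷ v) = ham u v
ham (false ∷ u) (true  ∷ v) = suc (ham u v)
ham (true  ∷ u) (false ∷ v) = suc (ham u v)

-- Elements of V(Q_d) ∪ E(Q_d). An edge is given by its two (adjacent) endpoints;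
-- edg u v and edg v u denote the same edge (see SameElem).
data Elem (d : ℕ) : Set where
  vtx : Vertex d → Elem d
  edg : (u v : Vertex d) → ham u v ≡ 1 → Elem d

SameElem : ∀ {d} → Elem d → Elem d → Set
SameElem (vtx u) (vtx v) = u ≡ v
SameElem (vtx _) (edg _ _ _) = ⊥
SameElem (edg _ _ _) (vtx _) = ⊥
SameElem (edg u v _) (edg u' v' _) = (u ≡ u' × v ≡ v') ⊎ (u ≡ v' × v ≡ u')

distE : ∀ {d} → Elem d → Vertex d → ℕ
distE (vtx u) x = ham u x
distE (edg u v _) x = ham u x ⊓ ham v x

MetricGenerator : (d : ℕ) → List (Vertex d) → Set
MetricGenerator d S =
  (u v : Vertex d) → u ≢ v → ∃[ x ] (x ∈ S × ham u x ≢ ham v x)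

MixedMetricGenerator : (d : ℕ) → List (Vertex d) → Set
MixedMetricGenerator d S =
  (a b : Elem d) → ¬ SameElem a b → ∃[ x ] (x ∈ S × distE a x ≢ distE b x)

-- k is the minimum cardinality of a set of vertices satisfying P
-- (sets represented as lists; duplicates only increase length, so the
-- minimum over lists equals the minimum over sets).
IsMinCard : ∀ {d} → (List (Vertex d) → Set) → ℕ → Set
IsMinCard {d} P k =
  (∃[ S ] (P S × length S ≡ k)) × ((S : List (Vertex d)) → P S → k ≤ length S)

IsDim : ℕ → ℕ → Set
IsDim d k = IsMinCard (MetricGenerator d) k

IsMdim : ℕ → ℕ → Set
IsMdim d k = IsMinCard (MixedMetricGenerator d) k

-- A metric generator S of Q_d is already a mixed one as soon as every coordinate takes both
-- values on S.  A vertex v and an edge uu′ in direction i are then told apart by parity: a member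
-- of S on u's side of coordinate i is nearer to u, one on the other side is nearer to u′, and
-- equal distances force equal parities.  Two edges are told apart because, for two adjacent
-- numbers, their minimum and the parity of one of them determine both, so endpoints of the same
-- parity have the same distances to all of S.
--
-- Replacing members of S by their antipodes keeps S a metric generator, as d(u, x̄) = d − d(u, x).
-- If S has three distinct members x₁, x₂, x₃, complement none of x₂, x₃, one of them, or both.
-- Were each of the four choices to leave some coordinate constant, these four coordinates would
-- be distinct, and the two vertices antipodal exactly on them would be equidistant from all of S.
-- If S has at most two distinct members, two of the first three coordinates have a constant xor
-- on S, with the same effect.  So a least metric generator yields a mixed one of the same size.

module Submission where

open import Defs
open import Data.Bool using (Bool; true; false; not; _∧_; _∨_; _xor_; if_then_else_)
open import Data.Bool.Properties
  using ( ∧-zeroʳ; ∧-identityʳ; ∨-identityʳ; not-¬; ¬-not; not-injective; not-involutive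
        ; not-distribˡ-xor; not-distribʳ-xor; xor-comm; xor-same; xor-identityʳ; xor-inverseˡ; xor-inverseʳ)
  renaming (_≟_ to _≟ᵇ_)
open import Data.Empty using (⊥; ⊥-elim)
open import Data.Fin using (Fin; zero; suc)
import Data.Fin.Properties as Fin
open import Data.List using (List; []; _∷_; length; map; _++_; deduplicate)
open import Data.List.Membership.Propositional using (_∈_; find; lose)
open import Data.List.Membership.Propositional.Properties using (∈-map⁺; ∈-++⁺ˡ; ∈-++⁺ʳ; ∈-deduplicate⁺; ∈-deduplicate⁻)
open import Data.List.Properties using (length-map)
open import Data.List.Relation.Binary.Subset.Propositional using (_⊆_)
open import Data.List.Relation.Unary.All as All using (All; []; _∷_)
open import Data.List.Relation.Unary.All.Properties using (¬All⇒Any¬)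
import Data.List.Relation.Unary.Any as Any
open import Data.List.Relation.Unary.Any using (here; there)
open import Data.List.Relation.Unary.AllPairs using ([]; _∷_)
open import Data.List.Relation.Unary.Unique.Propositional using (Unique)
open import Data.List.Relation.Unary.Unique.DecPropositional.Properties using (deduplicate-!)
open import Data.Nat using (ℕ; zero; suc; _+_; _⊓_; _≤_; _<_; s≤s; _≟_)
open import Data.Nat.Properties
  using ( suc-injective; n≤1+n; ≮⇒≥; m<1+n⇒m<n∨m≡n; ≤-refl; +-comm; +-suc; +-assoc; +-identityʳ
        ; +-cancelʳ-≡; +-cancelˡ-≡; +-commutativeSemigroup; m≤n⇒m⊓n≡m; m≥n⇒m⊓n≡n; ⊓-comm)
open import Data.Product using (_×_; _,_; proj₁; proj₂; ∃; ∃₂; ∃-syntax; map₂)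
open import Data.Sum using (_⊎_; inj₁; inj₂; [_,_]′) renaming (swap to ⊎-swap)
open import Data.Vec using ([]; _∷_; lookup; replicate; _[_]≔_) renaming (map to mapᵛ)
open import Data.Vec.Properties using (≡-dec; lookup-map; lookup∘update; lookup∘update′)
open import Function using (_∘_; case_of_)
open import Algebra.Properties.CommutativeSemigroup +-commutativeSemigroup using (xy∙z≈xz∙y; xy∙z≈x∙zy; xy∙z≈zy∙x)
open import Relation.Binary.Definitions using (DecidableEquality)
open import Relation.Nullary using (¬_; Dec; yes; no; does; ¬?)
open import Relation.Nullary.Decidable using (map′; _→-dec_; _⊎-dec_; decidable-stable; dec-true; dec-false)
open import Relation.Unary using (Decidable)
open import Relation.Binary.PropositionalEquality using (_≡_; _≢_; refl; sym; trans; cong; cong₂; subst; module ≡-Reasoning)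

∃-least : {Q : ℕ → Set} → Decidable Q → ∀ {n} → Q n → ∃[ k ] (Q k × (∀ m → Q m → k ≤ m))
∃-least {Q} Q? {n} qn with search (suc n)
  where
  search : ∀ b → (∃[ k ] (Q k × (∀ m → Q m → k ≤ m))) ⊎ (∀ m → m < b → ¬ Q m)
  search zero = inj₂ λ _ ()
  search (suc b) with search b
  ... | inj₁ least = inj₁ least
  ... | inj₂ none with Q? b
  ...   | yes qb = inj₁ (b , qb , λ m qm → ≮⇒≥ λ m<b → none m m<b qm)
  ...   | no ¬qb = inj₂ λ m m<1+b →
          [ (λ m<b → none m m<b) , (λ { refl → ¬qb }) ]′ (m<1+n⇒m<n∨m≡n m<1+b)
... | inj₁ least = least
... | inj₂ none = ⊥-elim (none n ≤-refl qn)

∃-member? : {A : Set} {P : A → Set} → Decidable P → (xs : List A) → Dec (∃[ x ] (x ∈ xs × P x))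
∃-member? P? xs = map′ find (λ (_ , x∈xs , px) → lose x∈xs px) (Any.any? P? xs)

distinguished-or-agree : {A : Set} (f g : A → ℕ) (xs : List A) →
  (∃[ x ] (x ∈ xs × f x ≢ g x)) ⊎ (∀ x → x ∈ xs → f x ≡ g x)
distinguished-or-agree f g xs with ∃-member? (λ x → ¬? (f x ≟ g x)) xs
... | yes found = inj₁ found
... | no none = inj₂ λ x x∈xs → decidable-stable (f x ≟ g x) λ f≢g → none (x , x∈xs , f≢g)

vertices : ∀ d → List (Vertex d)
vertices zero    = [] ∷ []
vertices (suc d) = map (false ∷_) (vertices d) ++ map (true ∷_) (vertices d)

∈-vertices : ∀ {d} (v : Vertex d) → v ∈ vertices d
∈-vertices []                = here refl
∈-vertices {suc d} (false ∷ v) = ∈-++⁺ˡ (∈-map⁺ (false ∷_) (∈-vertices v))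
∈-vertices {suc d} (true ∷ v)  = ∈-++⁺ʳ (map (false ∷_) (vertices d)) (∈-map⁺ (true ∷_) (∈-vertices v))

module _ {d : ℕ} {P : Vertex d → Set} (P? : Decidable P) where

  ∀-vertex? : Dec (∀ v → P v)
  ∀-vertex? = map′ (λ all v → All.lookup all (∈-vertices v)) (λ ∀P → All.tabulate λ {v} _ → ∀P v)
                   (All.all? P? (vertices d))

  ∃-vertex? : Dec (∃ P)
  ∃-vertex? = map′ (λ (v , _ , pv) → v , pv) (λ (v , pv) → v , ∈-vertices v , pv) (∃-member? P? (vertices d))

∃-list-of-length? : ∀ {d} {P : List (Vertex d) → Set} → Decidable P →
  ∀ k → Dec (∃[ S ] (P S × length S ≡ k))
∃-list-of-length? P? zero = map′ (λ p → [] , p , refl) (λ { ([] , p , _) → p ; (_ ∷ _ , _ , ()) }) (P? [])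
∃-list-of-length? P? (suc k) =
  map′ (λ (x , S , p , |S|≡k) → x ∷ S , p , cong suc |S|≡k)
       (λ { ([] , _ , ()) ; (x ∷ S , p , |S|≡k) → x , S , p , suc-injective |S|≡k })
       (∃-vertex? λ x → ∃-list-of-length? (λ S → P? (x ∷ S)) k)

isMinCard-exists : ∀ {d} {P : List (Vertex d) → Set} → Decidable P → ∀ S → P S → ∃[ k ] IsMinCard P k
isMinCard-exists P? S p with ∃-least (∃-list-of-length? P?) (S , p , refl)
... | k , witness , least = k , witness , λ T pT → least (length T) (T , pT , refl)

_≟ᵛ_ : ∀ {d} → DecidableEquality (Vertex d)
_≟ᵛ_ = ≡-dec _≟ᵇ_

metricGenerator? : ∀ d → Decidable (MetricGenerator d)
metricGenerator? d S = ∀-vertex? λ u → ∀-vertex? λ v →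
  ¬? (u ≟ᵛ v) →-dec ∃-member? (λ x → ¬? (ham u x ≟ ham v x)) S

mismatch : Bool → Bool → ℕ
mismatch false false = 0
mismatch true  true  = 0
mismatch false true  = 1
mismatch true  false = 1

mismatch-xor : ∀ t a b → mismatch (t xor (a xor b)) a ≡ mismatch t b
mismatch-xor false false false = refl
mismatch-xor false false true  = refl
mismatch-xor false true  false = refl
mismatch-xor false true  true  = refl
mismatch-xor true  false false = refl
mismatch-xor true  false true  = refl
mismatch-xor true  true  false = refl
mismatch-xor true  true  true  = refl

ham-∷ : ∀ {d} a b (u x : Vertex d) → ham (a ∷ u) (b ∷ x) ≡ mismatch a b + ham u x
ham-∷ false false u x = refl
ham-∷ false true  u x = refl
ham-∷ true  false u x = refl
ham-∷ true  true  u x = refl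

ham-self : ∀ {d} (u : Vertex d) → ham u u ≡ 0
ham-self []          = refl
ham-self (false ∷ u) = ham-self u
ham-self (true ∷ u)  = ham-self u

ham≡0⇒≡ : ∀ {d} (u v : Vertex d) → ham u v ≡ 0 → u ≡ v
ham≡0⇒≡ []          []          _ = refl
ham≡0⇒≡ (false ∷ u) (false ∷ v) e = cong (false ∷_) (ham≡0⇒≡ u v e)
ham≡0⇒≡ (true ∷ u)  (true ∷ v)  e = cong (true ∷_) (ham≡0⇒≡ u v e)
ham≡0⇒≡ (false ∷ u) (true ∷ v)  ()
ham≡0⇒≡ (true ∷ u)  (false ∷ v) ()

ham-antipode : ∀ {d} (u x : Vertex d) → ham u (mapᵛ not x) + ham u x ≡ d
ham-antipode []          []          = refl
ham-antipode (false ∷ u) (false ∷ x) = cong suc (ham-antipode u x)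
ham-antipode (true ∷ u)  (true ∷ x)  = cong suc (ham-antipode u x)
ham-antipode (false ∷ u) (true ∷ x)  = trans (+-suc _ _) (cong suc (ham-antipode u x))
ham-antipode (true ∷ u)  (false ∷ x) = trans (+-suc _ _) (cong suc (ham-antipode u x))

ham-update : ∀ {d} (w x : Vertex d) i a →
  ham (w [ i ]≔ a) x + mismatch (lookup w i) (lookup x i) ≡ ham w x + mismatch a (lookup x i)
ham-update (c ∷ w) (e ∷ x) zero a = begin
  ham (a ∷ w) (e ∷ x) + mismatch c e     ≡⟨ cong (_+ mismatch c e) (ham-∷ a e w x) ⟩
  mismatch a e + ham w x + mismatch c e  ≡⟨ xy∙z≈zy∙x (mismatch a e) (ham w x) (mismatch c e) ⟩
  mismatch c e + ham w x + mismatch a e  ≡⟨ cong (_+ mismatch a e) (ham-∷ c e w x) ⟨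
  ham (c ∷ w) (e ∷ x) + mismatch a e     ∎
  where open ≡-Reasoning
ham-update (c ∷ w) (e ∷ x) (suc i) a = begin
  ham (c ∷ w [ i ]≔ a) (e ∷ x) + m      ≡⟨ cong (_+ m) (ham-∷ c e (w [ i ]≔ a) x) ⟩
  mismatch c e + ham (w [ i ]≔ a) x + m ≡⟨ +-assoc (mismatch c e) _ m ⟩
  mismatch c e + (ham (w [ i ]≔ a) x + m) ≡⟨ cong (mismatch c e +_) (ham-update w x i a) ⟩
  mismatch c e + (ham w x + m′)          ≡⟨ +-assoc (mismatch c e) (ham w x) m′ ⟨
  mismatch c e + ham w x + m′            ≡⟨ cong (_+ m′) (ham-∷ c e w x) ⟨
  ham (c ∷ w) (e ∷ x) + m′               ∎
  where
  open ≡-Reasoning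
  m m′ : ℕ
  m  = mismatch (lookup w i) (lookup x i)
  m′ = mismatch a (lookup x i)

odd : ℕ → Bool
odd zero    = false
odd (suc n) = not (odd n)

parity : ∀ {d} → Vertex d → Bool
parity []      = false
parity (b ∷ v) = b xor parity v

xor-cancelˡ : ∀ a {b c} → a xor b ≡ a xor c → b ≡ c
xor-cancelˡ false e = e
xor-cancelˡ true  e = not-injective e

odd-ham : ∀ {d} (u x : Vertex d) → odd (ham u x) ≡ parity u xor parity x
odd-ham []          []          = refl
odd-ham (false ∷ u) (false ∷ x) = odd-ham u x
odd-ham (false ∷ u) (true ∷ x)  = trans (cong not (odd-ham u x)) (not-distribʳ-xor (parity u) (parity x))
odd-ham (true ∷ u)  (false ∷ x) = trans (cong not (odd-ham u x)) (not-distribˡ-xor (parity u) (parity x))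
odd-ham (true ∷ u)  (true ∷ x)  = begin
  odd (ham u x)                     ≡⟨ odd-ham u x ⟩
  parity u xor parity x             ≡⟨ not-involutive _ ⟨
  not (not (parity u xor parity x)) ≡⟨ cong not (not-distribʳ-xor (parity u) (parity x)) ⟩
  not (parity u xor not (parity x)) ≡⟨ not-distribˡ-xor (parity u) (not (parity x)) ⟩
  not (parity u) xor not (parity x) ∎
  where open ≡-Reasoning

ham≡⇒parity≡ : ∀ {d} (u v x : Vertex d) → ham u x ≡ ham v x → parity u ≡ parity v
ham≡⇒parity≡ u v x e = xor-cancelˡ (parity x)
  (trans (xor-comm (parity x) (parity u))
  (trans (sym (odd-ham u x)) (trans (cong odd e) (trans (odd-ham v x) (xor-comm (parity v) (parity x))))))

ham≡1⇒parity-not : ∀ {d} (u v : Vertex d) → ham u v ≡ 1 → parity v ≡ not (parity u)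
ham≡1⇒parity-not u v e = xor-cancelˡ (parity u)
  (trans (sym (odd-ham u v)) (trans (cong odd e) (sym (xor-inverseʳ (parity u)))))

flipAt : ∀ {d} → Vertex d → Fin d → Vertex d
flipAt u i = u [ i ]≔ not (lookup u i)

ham≡1⇒flipAt : ∀ {d} (u v : Vertex d) → ham u v ≡ 1 → ∃[ i ] v ≡ flipAt u i
ham≡1⇒flipAt []          []          ()
ham≡1⇒flipAt (false ∷ u) (false ∷ v) e = let i , v≡ = ham≡1⇒flipAt u v e in suc i , cong (false ∷_) v≡
ham≡1⇒flipAt (true ∷ u)  (true ∷ v)  e = let i , v≡ = ham≡1⇒flipAt u v e in suc i , cong (true ∷_) v≡
ham≡1⇒flipAt (false ∷ u) (true ∷ v)  e = zero , cong (true ∷_) (sym (ham≡0⇒≡ u v (suc-injective e)))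
ham≡1⇒flipAt (true ∷ u)  (false ∷ v) e = zero , cong (false ∷_) (sym (ham≡0⇒≡ u v (suc-injective e)))

module _ {d} (u x : Vertex d) (i : Fin d) where

  private
    ham-flipAt : ∀ b → lookup x i ≡ b →
      ham (flipAt u i) x + mismatch (lookup u i) b ≡ ham u x + mismatch (not (lookup u i)) b
    ham-flipAt _ refl = ham-update u x i _

    m+0≡n+1⇒m≡1+n : ∀ {m n} → m + 0 ≡ n + 1 → m ≡ suc n
    m+0≡n+1⇒m≡1+n {m} {n} e = trans (sym (+-identityʳ m)) (trans e (+-comm n 1))

  ham-flipAt-agree : lookup x i ≡ lookup u i → ham (flipAt u i) x ≡ suc (ham u x)
  ham-flipAt-agree xᵢ≡uᵢ with lookup u i | ham-flipAt (lookup u i) xᵢ≡uᵢ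
  ... | false | e = m+0≡n+1⇒m≡1+n e
  ... | true  | e = m+0≡n+1⇒m≡1+n e

  ham-flipAt-disagree : lookup x i ≡ not (lookup u i) → ham u x ≡ suc (ham (flipAt u i) x)
  ham-flipAt-disagree xᵢ≡¬uᵢ with lookup u i | ham-flipAt (not (lookup u i)) xᵢ≡¬uᵢ
  ... | false | e = m+0≡n+1⇒m≡1+n (sym e)
  ... | true  | e = m+0≡n+1⇒m≡1+n (sym e)

Adjacent : ℕ → ℕ → Set
Adjacent m n = n ≡ suc m ⊎ m ≡ suc n

n≡1+m⇒m⊓n≡m : ∀ {m n} → n ≡ suc m → m ⊓ n ≡ m
n≡1+m⇒m⊓n≡m {m} refl = m≤n⇒m⊓n≡m (n≤1+n m)

m≡1+n⇒m⊓n≡n : ∀ {m n} → m ≡ suc n → m ⊓ n ≡ n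
m≡1+n⇒m⊓n≡n {n = n} refl = m≥n⇒m⊓n≡n (n≤1+n n)

adjacent-≡ : ∀ {a a′ b b′} → Adjacent a a′ → Adjacent b b′ → odd a ≡ odd b → a ⊓ a′ ≡ b ⊓ b′ →
  a ≡ b × a′ ≡ b′
adjacent-≡ (inj₁ refl) (inj₁ refl) _ min≡ =
  let a≡b = trans (sym (n≡1+m⇒m⊓n≡m refl)) (trans min≡ (n≡1+m⇒m⊓n≡m refl)) in a≡b , cong suc a≡b
adjacent-≡ (inj₂ refl) (inj₂ refl) _ min≡ =
  let a′≡b′ = trans (sym (m≡1+n⇒m⊓n≡n refl)) (trans min≡ (m≡1+n⇒m⊓n≡n refl)) in cong suc a′≡b′ , a′≡b′
adjacent-≡ (inj₁ refl) (inj₂ refl) odd≡ min≡ =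
  ⊥-elim (not-¬ (cong odd (trans (sym (n≡1+m⇒m⊓n≡m refl)) (trans min≡ (m≡1+n⇒m⊓n≡n refl)))) odd≡)
adjacent-≡ (inj₂ refl) (inj₁ refl) odd≡ min≡ =
  ⊥-elim (not-¬ (cong odd (trans (sym (n≡1+m⇒m⊓n≡m refl)) (trans (sym min≡) (m≡1+n⇒m⊓n≡n refl))))
                (sym odd≡))

adjacent-ham : ∀ {d} (u v : Vertex d) → ham u v ≡ 1 → ∀ x → Adjacent (ham u x) (ham v x)
adjacent-ham u v p x with ham≡1⇒flipAt u v p
... | i , refl with lookup x i ≟ᵇ lookup u i
...   | yes xᵢ≡uᵢ = inj₁ (ham-flipAt-agree u x i xᵢ≡uᵢ)
...   | no  xᵢ≢uᵢ = inj₂ (ham-flipAt-disagree u x i (¬-not xᵢ≢uᵢ))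

resolves : ∀ {d S} → MetricGenerator d S → ∀ {u v} → (∀ x → x ∈ S → ham u x ≡ ham v x) → u ≡ v
resolves mg {u} {v} agree with u ≟ᵛ v
... | yes u≡v = u≡v
... | no  u≢v = let x , x∈S , differ = mg u v u≢v in ⊥-elim (differ (agree x x∈S))

HasBothValues : ∀ {d} → List (Vertex d) → Set
HasBothValues {d} S = ∀ (i : Fin d) b → ∃[ x ] (x ∈ S × lookup x i ≡ b)

vertex-edge-distinguished : ∀ {d S} → HasBothValues {d} S → ∀ v u u′ → ham u u′ ≡ 1 →
  ¬ (∀ x → x ∈ S → ham v x ≡ ham u x ⊓ ham u′ x)
vertex-edge-distinguished {S = S} both v u u′ p agree with ham≡1⇒flipAt u u′ p
... | i , refl = not-¬ (trans (sym v∼u′) v∼u) (ham≡1⇒parity-not u u′ p)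
  where
  v∼u : parity v ≡ parity u
  v∼u = let x , x∈S , xᵢ≡uᵢ = both i (lookup u i) in
    ham≡⇒parity≡ v u x (trans (agree x x∈S) (n≡1+m⇒m⊓n≡m (ham-flipAt-agree u x i xᵢ≡uᵢ)))
  v∼u′ : parity v ≡ parity u′
  v∼u′ = let x , x∈S , xᵢ≡¬uᵢ = both i (not (lookup u i)) in
    ham≡⇒parity≡ v u′ x (trans (agree x x∈S) (m≡1+n⇒m⊓n≡n (ham-flipAt-disagree u x i xᵢ≡¬uᵢ)))

edges-agree : ∀ {d S} → MetricGenerator d S → ∀ {u u′ w w′} →
  (∀ x → Adjacent (ham u x) (ham u′ x)) → (∀ x → Adjacent (ham w x) (ham w′ x)) → parity u ≡ parity w →
  (∀ x → x ∈ S → ham u x ⊓ ham u′ x ≡ ham w x ⊓ ham w′ x) → u ≡ w × u′ ≡ w′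
edges-agree {S = S} mg {u} {u′} {w} {w′} u∼u′ w∼w′ parity≡ agree =
  resolves mg (λ x x∈S → proj₁ (endpoints x x∈S)) , resolves mg (λ x x∈S → proj₂ (endpoints x x∈S))
  where
  endpoints : ∀ x → x ∈ S → ham u x ≡ ham w x × ham u′ x ≡ ham w′ x
  endpoints x x∈S = adjacent-≡ (u∼u′ x) (w∼w′ x)
    (trans (odd-ham u x) (trans (cong (_xor parity x) parity≡) (sym (odd-ham w x))))
    (agree x x∈S)

same-if-undistinguished : ∀ {d S} → MetricGenerator d S → HasBothValues S →
  ∀ a b → (∀ x → x ∈ S → distE a x ≡ distE b x) → SameElem a b
same-if-undistinguished mg both (vtx u) (vtx v) agree = resolves mg agree
same-if-undistinguished mg both (vtx v) (edg u u′ p) agree =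
  ⊥-elim (vertex-edge-distinguished both v u u′ p agree)
same-if-undistinguished mg both (edg u u′ p) (vtx v) agree =
  ⊥-elim (vertex-edge-distinguished both v u u′ p λ x x∈S → sym (agree x x∈S))
same-if-undistinguished mg both (edg u u′ p) (edg w w′ q) agree with parity u ≟ᵇ parity w
... | yes u∼w = inj₁ (edges-agree mg (adjacent-ham u u′ p) (adjacent-ham w w′ q) u∼w agree)
... | no  u≁w = inj₂ (edges-agree mg (adjacent-ham u u′ p) (⊎-swap ∘ adjacent-ham w w′ q)
                        (trans (¬-not u≁w) (sym (ham≡1⇒parity-not w w′ q)))
                        λ x x∈S → trans (agree x x∈S) (⊓-comm (ham w x) (ham w′ x)))

mixed-if-hasBothValues : ∀ {d S} → MetricGenerator d S → HasBothValues S → MixedMetricGenerator d S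
mixed-if-hasBothValues {S = S} mg both a b a≠b with distinguished-or-agree (distE a) (distE b) S
... | inj₁ found = found
... | inj₂ agree = ⊥-elim (a≠b (same-if-undistinguished mg both a b agree))

mixed⇒metric : ∀ {d S} → MixedMetricGenerator d S → MetricGenerator d S
mixed⇒metric mixed u v = mixed (vtx u) (vtx v)

complementIf : ∀ {d} → (Vertex d → Bool) → Vertex d → Vertex d
complementIf φ x = if φ x then mapᵛ not x else x

lookup-complementIf : ∀ {d} φ (x : Vertex d) i → lookup (complementIf φ x) i ≡ lookup x i xor φ x
lookup-complementIf φ x i with φ x
... | true  = trans (lookup-map i not x) (xor-comm true (lookup x i))
... | false = sym (xor-identityʳ (lookup x i))

complementIf-reflects-ham≡ : ∀ {d} φ (u v x : Vertex d) →
  ham u (complementIf φ x) ≡ ham v (complementIf φ x) → ham u x ≡ ham v x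
complementIf-reflects-ham≡ φ u v x e with φ x
... | false = e
... | true  = +-cancelˡ-≡ (ham u (mapᵛ not x)) _ _
  (trans (ham-antipode u x) (trans (sym (ham-antipode v x)) (cong (_+ ham v x) (sym e))))

complementIf-metricGenerator : ∀ {d S} φ → MetricGenerator d S → MetricGenerator d (map (complementIf φ) S)
complementIf-metricGenerator φ mg u v u≢v =
  let x , x∈S , differ = mg u v u≢v in
  complementIf φ x , ∈-map⁺ (complementIf φ) x∈S , differ ∘ complementIf-reflects-ham≡ φ u v x

-- Coordinate j is constantly c on S once the vertices x with φ x are complemented.
Aligned : ∀ {d} → List (Vertex d) → (Vertex d → Bool) → Fin d → Bool → Set
Aligned S φ j c = All (λ x → lookup x j xor φ x ≡ c) S

Unaligned : ∀ {d} → List (Vertex d) → (Vertex d → Bool) → Set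
Unaligned {d} S φ = ∀ (j : Fin d) c → ¬ Aligned S φ j c

aligned-or-unaligned : ∀ {d} (S : List (Vertex d)) φ → (∃₂ λ j c → Aligned S φ j c) ⊎ Unaligned S φ
aligned-or-unaligned S φ with Fin.any? (λ j → ∃-bool? λ c → All.all? (λ x → lookup x j xor φ x ≟ᵇ c) S)
  where
  ∃-bool? : {P : Bool → Set} → Decidable P → Dec (∃ P)
  ∃-bool? P? = map′ [ (false ,_) , (true ,_) ]′ (λ { (false , p) → inj₁ p ; (true , p) → inj₂ p })
                    (P? false ⊎-dec P? true)
... | yes (j , c , aligned) = inj₁ (j , c , aligned)
... | no none = inj₂ λ j c aligned → none (j , c , aligned)

unaligned⇒hasBothValues : ∀ {d S} φ → Unaligned {d} S φ → HasBothValues (map (complementIf φ) S)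
unaligned⇒hasBothValues {S = S} φ unaligned i b =
  let x , x∈S , ≢¬b = find (¬All⇒Any¬ (λ x → lookup x i xor φ x ≟ᵇ not b) S (unaligned i (not b))) in
  complementIf φ x , ∈-map⁺ (complementIf φ) x∈S ,
  trans (lookup-complementIf φ x i) (trans (¬-not ≢¬b) (not-involutive b))

Assignment : ℕ → Set
Assignment d = List (Fin d × Bool)

assign : ∀ {d} → Vertex d → Assignment d → Vertex d
assign z []             = z
assign z ((i , b) ∷ as) = assign z as [ i ]≔ b

coordinates : ∀ {d} → Assignment d → List (Fin d)
coordinates = map proj₁

mismatches : ∀ {d} → Assignment d → Vertex d → ℕ
mismatches []             x = 0
mismatches ((i , b) ∷ as) x = mismatch b (lookup x i) + mismatches as x

restore : ∀ {d} → Vertex d → Assignment d → Assignment d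
restore z = map λ (i , _) → i , lookup z i

opposite : ∀ {d} → Assignment d → Assignment d
opposite = map (map₂ not)

coordinates-opposite : ∀ {d} (as : Assignment d) → coordinates (opposite as) ≡ coordinates as
coordinates-opposite []       = refl
coordinates-opposite (_ ∷ as) = cong (_ ∷_) (coordinates-opposite as)

restore-opposite : ∀ {d} (z : Vertex d) as → restore z (opposite as) ≡ restore z as
restore-opposite z []       = refl
restore-opposite z (_ ∷ as) = cong (_ ∷_) (restore-opposite z as)

lookup-assign-fresh : ∀ {d} (z : Vertex d) {i} as → All (i ≢_) (coordinates as) →
  lookup (assign z as) i ≡ lookup z i
lookup-assign-fresh z []             []             = refl
lookup-assign-fresh z {i} ((j , b) ∷ as) (i≢j ∷ fresh) =
  trans (lookup∘update′ i≢j (assign z as) b) (lookup-assign-fresh z as fresh)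

ham-assign : ∀ {d} (z x : Vertex d) as → Unique (coordinates as) →
  ham (assign z as) x + mismatches (restore z as) x ≡ ham z x + mismatches as x
ham-assign z x []             []               = refl
ham-assign z x ((i , b) ∷ as) (fresh ∷ unique) = begin
  ham (w [ i ]≔ b) x + (mismatch (lookup z i) xᵢ + R)
    ≡⟨ cong (λ c → ham (w [ i ]≔ b) x + (mismatch c xᵢ + R)) (lookup-assign-fresh z as fresh) ⟨
  ham (w [ i ]≔ b) x + (mismatch (lookup w i) xᵢ + R) ≡⟨ +-assoc (ham (w [ i ]≔ b) x) _ R ⟨
  ham (w [ i ]≔ b) x + mismatch (lookup w i) xᵢ + R   ≡⟨ cong (_+ R) (ham-update w x i b) ⟩
  ham w x + mismatch b xᵢ + R                          ≡⟨ xy∙z≈xz∙y (ham w x) _ R ⟩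
  ham w x + R + mismatch b xᵢ                          ≡⟨ cong (_+ mismatch b xᵢ) (ham-assign z x as unique) ⟩
  ham z x + mismatches as x + mismatch b xᵢ            ≡⟨ xy∙z≈x∙zy (ham z x) _ _ ⟩
  ham z x + (mismatch b xᵢ + mismatches as x)          ∎
  where
  open ≡-Reasoning
  w  = assign z as
  xᵢ = lookup x i
  R  = mismatches (restore z as) x

-- Two vertices that are antipodal on the coordinates of the assignment and equal elsewhere
-- are equidistant from every x that disagrees with the assignment on exactly half of them.
balanced⇒¬metricGenerator : ∀ {d S} (a : Fin d × Bool) as → Unique (coordinates (a ∷ as)) →
  (∀ x → x ∈ S → mismatches (a ∷ as) x ≡ mismatches (opposite (a ∷ as)) x) → ¬ MetricGenerator d S
balanced⇒¬metricGenerator {d} {S} a@(i , b) as unique balanced mg =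
  let x , x∈S , differ = mg u v u≢v in differ (equidistant x x∈S)
  where
  z = replicate d false
  u = assign z (a ∷ as)
  v = assign z (opposite (a ∷ as))
  u≢v : u ≢ v
  u≢v u≡v = not-¬ (trans (cong (λ w → lookup w i) (sym u≡v)) (lookup∘update i (assign z as) b))
                  (lookup∘update i (assign z (opposite as)) (not b))
  equidistant : ∀ x → x ∈ S → ham u x ≡ ham v x
  equidistant x x∈S = +-cancelʳ-≡ _ (ham u x) (ham v x) (begin
    ham u x + mismatches (restore z (a ∷ as)) x            ≡⟨ ham-assign z x (a ∷ as) unique ⟩
    ham z x + mismatches (a ∷ as) x                        ≡⟨ cong (ham z x +_) (balanced x x∈S) ⟩
    ham z x + mismatches (opposite (a ∷ as)) x
      ≡⟨ ham-assign z x (opposite (a ∷ as)) (subst Unique (sym (coordinates-opposite (a ∷ as))) unique) ⟨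
    ham v x + mismatches (restore z (opposite (a ∷ as))) x
      ≡⟨ cong (λ r → ham v x + mismatches r x) (restore-opposite z (a ∷ as)) ⟩
    ham v x + mismatches (restore z (a ∷ as)) x            ∎)
    where open ≡-Reasoning

xor-exchange : ∀ a b c e → a xor b ≡ c xor e → b xor e ≡ a xor c
xor-exchange false b false e b≡e   = trans (cong (b xor_) (sym b≡e)) (xor-same b)
xor-exchange true  b true  e ¬b≡¬e = trans (cong (b xor_) (sym (not-injective ¬b≡¬e))) (xor-same b)
xor-exchange false b true  e b≡¬e  = trans (cong (_xor e) b≡¬e) (xor-inverseˡ e)
xor-exchange true  b false e ¬b≡e  = trans (cong (b xor_) (sym ¬b≡e)) (xor-inverseʳ b)

bool-pigeonhole : ∀ a b c → a ≡ b ⊎ a ≡ c ⊎ b ≡ c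
bool-pigeonhole a b c with a ≟ᵇ b | a ≟ᵇ c
... | yes a≡b | _       = inj₁ a≡b
... | no _    | yes a≡c = inj₂ (inj₁ a≡c)
... | no a≢b  | no a≢c  = inj₂ (inj₂ (not-injective (trans (sym (¬-not a≢b)) (¬-not a≢c))))

xor-constant⇒¬metricGenerator : ∀ {d S} {j k : Fin d} c → j ≢ k →
  All (λ x → lookup x j xor lookup x k ≡ c) S → ¬ MetricGenerator d S
xor-constant⇒¬metricGenerator {S = S} {j} {k} c j≢k constant =
  balanced⇒¬metricGenerator (j , true) ((k , c) ∷ []) ((j≢k ∷ []) ∷ [] ∷ []) balanced
  where
  identity : ∀ a b →
    mismatch true a + (mismatch (a xor b) b + 0) ≡ mismatch false a + (mismatch (not (a xor b)) b + 0)
  identity false false = refl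
  identity false true  = refl
  identity true  false = refl
  identity true  true  = refl
  pair : Bool → Assignment _
  pair c = (j , true) ∷ (k , c) ∷ []
  balanced : ∀ x → x ∈ S → mismatches (pair c) x ≡ mismatches (opposite (pair c)) x
  balanced x x∈S = subst (λ c → mismatches (pair c) x ≡ mismatches (opposite (pair c)) x)
                         (All.lookup constant x∈S) (identity (lookup x j) (lookup x k))

equal-differences⇒¬metricGenerator : ∀ {d S} {x₁ x₂ : Vertex d} {j k} → j ≢ k → S ⊆ x₁ ∷ x₂ ∷ [] →
  lookup x₁ j xor lookup x₂ j ≡ lookup x₁ k xor lookup x₂ k → ¬ MetricGenerator d S
equal-differences⇒¬metricGenerator {x₁ = x₁} {x₂} {j} {k} j≢k S⊆ δ≡ =
  xor-constant⇒¬metricGenerator (lookup x₁ j xor lookup x₁ k) j≢k (All.tabulate (constant ∘ S⊆))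
  where
  constant : ∀ {x} → x ∈ x₁ ∷ x₂ ∷ [] → lookup x j xor lookup x k ≡ lookup x₁ j xor lookup x₁ k
  constant (here refl)         = refl
  constant (there (here refl)) = xor-exchange (lookup x₁ j) (lookup x₂ j) (lookup x₁ k) (lookup x₂ k) δ≡

two-points-¬metricGenerator : ∀ {d S} {x₁ x₂ : Vertex d} → 3 ≤ d → S ⊆ x₁ ∷ x₂ ∷ [] →
  ¬ MetricGenerator d S
two-points-¬metricGenerator {x₁ = x₁} {x₂} (s≤s (s≤s (s≤s _))) S⊆
  with bool-pigeonhole (δ zero) (δ (suc zero)) (δ (suc (suc zero)))
  where
  δ : ∀ i → Bool
  δ i = lookup x₁ i xor lookup x₂ i
... | inj₁ δ₀≡δ₁        = equal-differences⇒¬metricGenerator (λ ()) S⊆ δ₀≡δ₁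
... | inj₂ (inj₁ δ₀≡δ₂) = equal-differences⇒¬metricGenerator (λ ()) S⊆ δ₀≡δ₂
... | inj₂ (inj₂ δ₁≡δ₂) = equal-differences⇒¬metricGenerator (λ ()) S⊆ δ₁≡δ₂

record DistinctTriple {A : Set} (S : List A) : Set where
  field
    x₁ x₂ x₃ : A
    x₁∈S : x₁ ∈ S
    x₂∈S : x₂ ∈ S
    x₃∈S : x₃ ∈ S
    x₁≢x₂ : x₁ ≢ x₂
    x₁≢x₃ : x₁ ≢ x₃
    x₂≢x₃ : x₂ ≢ x₃

distinctTriple-or-two-points : ∀ {A : Set} → DecidableEquality A → A → (S : List A) →
  DistinctTriple S ⊎ ∃₂ λ a b → S ⊆ a ∷ b ∷ []
distinctTriple-or-two-points {A} _≟_ a₀ S =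
  split (deduplicate _≟_ S) (deduplicate-! _≟_ S) (∈-deduplicate⁻ _≟_ S) (∈-deduplicate⁺ _≟_)
  where
  split : ∀ T → Unique T → T ⊆ S → S ⊆ T → DistinctTriple S ⊎ ∃₂ λ a b → S ⊆ a ∷ b ∷ []
  split []          _ _ S⊆T = inj₂ (a₀ , a₀ , λ x∈S → case S⊆T x∈S of λ ())
  split (a ∷ [])     _ _ S⊆T = inj₂ (a , a , λ x∈S → case S⊆T x∈S of λ { (here x≡a) → here x≡a })
  split (a ∷ b ∷ []) _ _ S⊆T = inj₂ (a , b , S⊆T)
  split (a ∷ b ∷ c ∷ _) ((a≢b ∷ a≢c ∷ _) ∷ (b≢c ∷ _) ∷ _) T⊆S _ = inj₁ record
    { x₁∈S = T⊆S (here refl) ; x₂∈S = T⊆S (there (here refl)) ; x₃∈S = T⊆S (there (there (here refl)))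
    ; x₁≢x₂ = a≢b ; x₁≢x₃ = a≢c ; x₂≢x₃ = b≢c }

aligned-unique : ∀ {d S φ ψ} {j : Fin d} {c c′ x y} → Aligned S φ j c → Aligned S ψ j c′ →
  x ∈ S → y ∈ S → φ x ≡ ψ x → φ y ≡ ψ y
aligned-unique {j = j} {x = x} {y} φ-aligned ψ-aligned x∈S y∈S φx≡ψx =
  xor-cancelˡ (lookup y j) (trans (All.lookup φ-aligned y∈S) (trans c≡c′ (sym (All.lookup ψ-aligned y∈S))))
  where
  c≡c′ = trans (sym (All.lookup φ-aligned x∈S))
               (trans (cong (lookup x j xor_) φx≡ψx) (All.lookup ψ-aligned x∈S))

mismatch-aligned : ∀ {d S φ} {j : Fin d} {c x} → Aligned S φ j c → x ∈ S →
  ∀ t → mismatch (t xor c) (lookup x j) ≡ mismatch t (φ x)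
mismatch-aligned {φ = φ} {j} {x = x} aligned x∈S t =
  trans (cong (λ c → mismatch (t xor c) (lookup x j)) (sym (All.lookup aligned x∈S)))
        (mismatch-xor t (lookup x j) (φ x))

mismatch-aligned-not : ∀ {d S φ} {j : Fin d} {c x} → Aligned S φ j c → x ∈ S →
  ∀ t → mismatch (not (t xor c)) (lookup x j) ≡ mismatch (not t) (φ x)
mismatch-aligned-not {j = j} {c} {x} aligned x∈S t =
  trans (cong (λ b → mismatch b (lookup x j)) (not-distribˡ-xor t c)) (mismatch-aligned aligned x∈S (not t))

select : Bool → Bool → Bool → Bool → Bool
select p q P Q = (p ∧ P) ∨ (q ∧ Q)

-- Unless P and Q are both true, (false, P ∨ Q, Q, P) differs from (true, true, false, false)
-- in exactly two places.
select-balanced : ∀ P Q → (P ≡ true → Q ≡ true → ⊥) →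
    mismatch true  (select false false P Q) + (mismatch true  (select true true P Q)
  + (mismatch false (select false true P Q) + (mismatch false (select true false P Q) + 0)))
  ≡ mismatch false (select false false P Q) + (mismatch false (select true true P Q)
  + (mismatch true  (select false true P Q) + (mismatch true  (select true false P Q) + 0)))
select-balanced false false _       = refl
select-balanced false true  _       = refl
select-balanced true  false _       = refl
select-balanced true  true  not-both = ⊥-elim (not-both refl refl)

module Candidates {d} {S : List (Vertex d)} (triple : DistinctTriple S) where
  open DistinctTriple triple

  -- p and q say whether to complement x₂ and x₃.
  candidate : Bool → Bool → Vertex d → Bool
  candidate p q x = select p q (does (x ≟ᵛ x₂)) (does (x ≟ᵛ x₃))

  candidate-x₁ : ∀ p q → candidate p q x₁ ≡ false
  candidate-x₁ p q rewrite dec-false (x₁ ≟ᵛ x₂) x₁≢x₂ | dec-false (x₁ ≟ᵛ x₃) x₁≢x₃ =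
    cong₂ _∨_ (∧-zeroʳ p) (∧-zeroʳ q)

  candidate-x₂ : ∀ p q → candidate p q x₂ ≡ p
  candidate-x₂ p q rewrite dec-true (x₂ ≟ᵛ x₂) refl | dec-false (x₂ ≟ᵛ x₃) x₂≢x₃ =
    trans (cong₂ _∨_ (∧-identityʳ p) (∧-zeroʳ q)) (∨-identityʳ p)

  candidate-x₃ : ∀ p q → candidate p q x₃ ≡ q
  candidate-x₃ p q rewrite dec-false (x₃ ≟ᵛ x₂) (x₂≢x₃ ∘ sym) | dec-true (x₃ ≟ᵛ x₃) refl =
    cong₂ _∨_ (∧-zeroʳ p) (∧-identityʳ q)

  candidates-distinct : ∀ p q p′ q′ {j k c c′} → (p , q) ≢ (p′ , q′) →
    Aligned S (candidate p q) j c → Aligned S (candidate p′ q′) k c′ → j ≢ k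
  candidates-distinct p q p′ q′ pq≢p′q′ aligned aligned′ refl =
    pq≢p′q′ (cong₂ _,_ (trans (sym (candidate-x₂ p q)) (trans (agree x₂∈S) (candidate-x₂ p′ q′)))
                       (trans (sym (candidate-x₃ p q)) (trans (agree x₃∈S) (candidate-x₃ p′ q′))))
    where
    agree : ∀ {y} → y ∈ S → candidate p q y ≡ candidate p′ q′ y
    agree y∈S = aligned-unique aligned aligned′ x₁∈S y∈S (trans (candidate-x₁ p q) (sym (candidate-x₁ p′ q′)))

  not-both : ∀ x → does (x ≟ᵛ x₂) ≡ true → does (x ≟ᵛ x₃) ≡ true → ⊥
  not-both x with x ≟ᵛ x₂ | x ≟ᵛ x₃
  ... | yes x≡x₂ | yes x≡x₃ = λ _ _ → x₂≢x₃ (trans (sym x≡x₂) x≡x₃)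
  ... | no _     | _        = λ ()
  ... | yes _    | no _     = λ _ ()

  four-aligned⇒¬metricGenerator : ∀ {j₀₀ j₁₁ j₀₁ j₁₀ c₀₀ c₁₁ c₀₁ c₁₀} →
    Aligned S (candidate false false) j₀₀ c₀₀ → Aligned S (candidate true true) j₁₁ c₁₁ →
    Aligned S (candidate false true) j₀₁ c₀₁ → Aligned S (candidate true false) j₁₀ c₁₀ →
    ¬ MetricGenerator d S
  four-aligned⇒¬metricGenerator {j₀₀} {j₁₁} {j₀₁} {j₁₀} {c₀₀} {c₁₁} {c₀₁} {c₁₀} a₀₀ a₁₁ a₀₁ a₁₀ =
    balanced⇒¬metricGenerator (j₀₀ , true xor c₀₀) as unique balanced
    where
    as : Assignment d
    as = (j₁₁ , true xor c₁₁) ∷ (j₀₁ , false xor c₀₁) ∷ (j₁₀ , false xor c₁₀) ∷ []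
    flips : Assignment d
    flips = (j₀₀ , true xor c₀₀) ∷ as
    unique : Unique (coordinates flips)
    unique = (candidates-distinct false false true true (λ ()) a₀₀ a₁₁
             ∷ candidates-distinct false false false true (λ ()) a₀₀ a₀₁
             ∷ candidates-distinct false false true false (λ ()) a₀₀ a₁₀ ∷ [])
           ∷ (candidates-distinct true true false true (λ ()) a₁₁ a₀₁
             ∷ candidates-distinct true true true false (λ ()) a₁₁ a₁₀ ∷ [])
           ∷ (candidates-distinct false true true false (λ ()) a₀₁ a₁₀ ∷ [])
           ∷ [] ∷ []
    balanced : ∀ x → x ∈ S → mismatches flips x ≡ mismatches (opposite flips) x
    balanced x x∈S = trans
      (cong₂ _+_ (m a₀₀ true) (cong₂ _+_ (m a₁₁ true) (cong₂ _+_ (m a₀₁ false) (cong (_+ 0) (m a₁₀ false)))))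
      (trans (select-balanced _ _ (not-both x))
      (sym (cong₂ _+_ (m¬ a₀₀ true) (cong₂ _+_ (m¬ a₁₁ true)
                                     (cong₂ _+_ (m¬ a₀₁ false) (cong (_+ 0) (m¬ a₁₀ false)))))))
      where
      m = λ {φ} {j} {c} (aligned : Aligned S φ j c) → mismatch-aligned aligned x∈S
      m¬ = λ {φ} {j} {c} (aligned : Aligned S φ j c) → mismatch-aligned-not aligned x∈S

  unaligned-candidate : MetricGenerator d S → ∃[ φ ] Unaligned S φ
  unaligned-candidate mg with aligned-or-unaligned S (candidate false false) | aligned-or-unaligned S (candidate true true)
                            | aligned-or-unaligned S (candidate false true)  | aligned-or-unaligned S (candidate true false)
  ... | inj₂ unaligned | _ | _ | _ = candidate false false , unaligned
  ... | inj₁ _ | inj₂ unaligned | _ | _ = candidate true true , unaligned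
  ... | inj₁ _ | inj₁ _ | inj₂ unaligned | _ = candidate false true , unaligned
  ... | inj₁ _ | inj₁ _ | inj₁ _ | inj₂ unaligned = candidate true false , unaligned
  ... | inj₁ (_ , _ , a₀₀) | inj₁ (_ , _ , a₁₁) | inj₁ (_ , _ , a₀₁) | inj₁ (_ , _ , a₁₀) =
    ⊥-elim (four-aligned⇒¬metricGenerator a₀₀ a₁₁ a₀₁ a₁₀ mg)

vertices-metricGenerator : ∀ d → MetricGenerator d (vertices d)
vertices-metricGenerator d u v u≢v =
  u , ∈-vertices u , λ e → u≢v (sym (ham≡0⇒≡ v u (trans (sym e) (ham-self u))))

complemented-mixed : ∀ {d S} → 3 ≤ d → MetricGenerator d S →
  ∃[ φ ] MixedMetricGenerator d (map (complementIf φ) S)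
complemented-mixed {d} {S} 3≤d mg with distinctTriple-or-two-points _≟ᵛ_ (replicate d false) S
... | inj₂ (_ , _ , S⊆) = ⊥-elim (two-points-¬metricGenerator 3≤d S⊆ mg)
... | inj₁ triple =
  let φ , unaligned = Candidates.unaligned-candidate triple mg in
  φ , mixed-if-hasBothValues (complementIf-metricGenerator φ mg) (unaligned⇒hasBothValues φ unaligned)

theorem7 : (d : ℕ) → 3 ≤ d → ∃[ k ] (IsDim d k × IsMdim d k)
theorem7 d 3≤d =
  let k , (S , mg , |S|≡k) , minimal =
        isMinCard-exists (metricGenerator? d) (vertices d) (vertices-metricGenerator d)
      φ , mixed = complemented-mixed 3≤d mg
  in k , ((S , mg , |S|≡k) , minimal)
       , ((map (complementIf φ) S , mixed , trans (length-map (complementIf φ) S) |S|≡k)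
         , λ T → minimal T ∘ mixed⇒metric)
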